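{- Let $\Xi_F=(S,\mathrm{wt})$ be a full passport with $|S|=N\ge2$ and $P=(s_1,\dots,s_N)$ a permutation of $S$. Each horizontal rectangle in $R(P)$ defines an edge of $G(P)$ connecting some black vertex $k$ and some white vertex $l$; the rectangle lies above the $x$-axis when $k<l$ and below the $x$-axis when $k>l$.
   Context: Full passport: finite set $S$ with $\mathrm{wt}:S\to\mathbb{R}\setminus\{0\}$, $\sum_{s\in S}\mathrm{wt}(s)=0$. A permutation is a sequence $(s_1,\dots,s_N)$ listing each element of $S$ once; $H_0=0$, $H_i=\sum_{j\le i}\mathrm{wt}(s_j)$. Vertex $i\in\{1,\dots,N\}$ is black if $\mathrm{wt}(s_i)>0$ and white if $\mathrm{wt}(s_i)<0$. Set $\mathrm{Rec}_i=[i,i+1]\times[\min\{0,H_i\},\max\{0,H_i\}]$, $R(P)=\bigcup_{i=1}^N\mathrm{Rec}_i$; the $i$-th vertical line is $\{i\}\times[\min(H_{i-1},H_i),\max(H_{i-1},H_i)]$. Extend each segment $[i,i+1]\times\{H_i\}$ in both directions until it reaches a boundary vertical line of $R(P)$; these maximal segments together with $[1,N]\times\{0\}$ cut $R(P)$ into horizontal rectangles. A rectangle bounded on its two sides by the $k$-th and $l$-th vertical lines gives an edge of $G(P)$ between vertices $k$ and $l$, with weight equal to its height. -}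

module Defs where

open import Level using (0ℓ)
open import Data.Nat as ℕ using (ℕ; zero; suc; _∸_; _<?_)
open import Data.Fin using (Fin; fromℕ<) renaming (zero to fzero; suc to fsuc)
open import Data.Fin.Permutation using (Permutation′; _⟨$⟩ʳ_)
open import Data.Product using (_×_; Σ)
open import Data.Sum using (_⊎_)
open import Relation.Nullary using (¬_; yes; no)
open import Relation.Binary.PropositionalEquality using (_≡_; _≢_)
open import Relation.Binary.Core using (Rel)
open import Algebra.Structures using (IsAbelianGroup)
open import Relation.Binary.Structures using (IsTotalOrder)

-- Weights: the paper uses ℝ.  There are no reals in agda-stdlib, so we
-- work over an arbitrary (totally) ordered abelian group, of which
-- (ℝ, +, ≤) is an instance.

record OrderedAbelianGroup : Set₁ where
  infixl 6 _+_
  infix 4 _≤_ _<_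
  field
    Carrier        : Set
    _+_            : Carrier → Carrier → Carrier
    0#             : Carrier
    -_             : Carrier → Carrier
    _≤_            : Rel Carrier 0ℓ
    isAbelianGroup : IsAbelianGroup _≡_ _+_ 0# -_
    isTotalOrder   : IsTotalOrder _≡_ _≤_
    +-monoˡ-≤      : ∀ c {a b} → a ≤ b → a + c ≤ b + c

  _<_ : Rel Carrier 0ℓ
  a < b = (a ≤ b) × (a ≢ b)

  Between : Carrier → Carrier → Carrier → Set
  Between a b y = ((a ≤ y) × (y ≤ b)) ⊎ ((b ≤ y) × (y ≤ a))

  sumFin : ∀ {n} → (Fin n → Carrier) → Carrier
  sumFin {zero}  f = 0#
  sumFin {suc n} f = f fzero + sumFin (λ i → f (fsuc i))

-- Full passport: S is a finite set of size N, represented as Fin N,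
-- with nonzero weights summing to 0.

module _ (G : OrderedAbelianGroup) where
  open OrderedAbelianGroup G

  record FullPassport (N : ℕ) : Set where
    field
      wt        : Fin N → Carrier
      wt-nonzero : ∀ s → wt s ≢ 0#
      wt-sum    : sumFin wt ≡ 0#

-- Geometry of R(P) for a permutation P = (s_1,…,s_N) of S.
-- P is given by a permutation π of Fin N, with s_i = π (i-1).
-- Positions / vertices / vertical lines are indexed 1,…,N by ℕ.

module Geometry (G : OrderedAbelianGroup) {N : ℕ}
                (Ξ : FullPassport G N) (π : Permutation′ N) where
  open OrderedAbelianGroup G
  open FullPassport Ξ

  -- w i = wt(s_i) for 1 ≤ i ≤ N  (0# outside this range; never used there)
  w : ℕ → Carrier
  w zero = 0#
  w (suc j) with j <? N
  ... | yes p = wt (π ⟨$⟩ʳ fromℕ< p)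
  ... | no _  = 0#

  H : ℕ → Carrier
  H zero    = 0#
  H (suc i) = H i + w (suc i)

  Black White : ℕ → Set
  Black i = 0# < w i
  White i = w i < 0#

  -- the point (x , y) with x ∈ (j , j+1) (interior abscissa) lies in Rec_j,
  -- i.e. y ∈ [min{0,H_j}, max{0,H_j}]
  InCol : ℕ → Carrier → Set
  InCol j y = Between 0# (H j) y

  -- the j-th vertical line {j} × [min(H_{j-1},H_j), max(H_{j-1},H_j)]
  -- contains height y
  OnLine : ℕ → Carrier → Set
  OnLine j y = Between (H (j ∸ 1)) (H j) y

  -- Some cutting segment lies at height y over the column [j , j+1]:
  -- either the axis segment [1,N] × {0}, or the maximal extension of the
  -- segment [i,i+1] × {H_i} (for some 1 ≤ i ≤ N with H_i = y), which runs
  -- through every column between i and j (all of which contain height y).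
  Cut : Carrier → ℕ → Set
  Cut y j =
      (y ≡ 0#)
    ⊎ Σ ℕ (λ i → (1 ℕ.≤ i) × (i ℕ.≤ N) × (H i ≡ y)
         × (∀ m → i ℕ.⊓ j ℕ.≤ m → m ℕ.≤ i ℕ.⊔ j → InCol m y))

  -- A horizontal rectangle [k,l] × [c,d] of the subdivision of R(P),
  -- bounded on the left by the k-th and on the right by the l-th vertical
  -- line (so k < l).
  record HRect (k l : ℕ) (c d : Carrier) : Set where
    field
      k≥1   : 1 ℕ.≤ k
      k<l   : k ℕ.< l
      l≤N   : l ℕ.≤ N
      c<d   : c < d
      inside : ∀ j → k ℕ.≤ j → j ℕ.< l → InCol j c × InCol j d
      -- its left side is (part of) the k-th vertical line, which is a
      -- boundary line: R(P) does not continue to the left of it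
      left-line  : OnLine k c × OnLine k d
      left-bdry  : (k ≡ 1) ⊎ (∀ y → c < y → y < d → ¬ InCol (k ∸ 1) y)
      -- its right side is (part of) the l-th vertical line, a boundary line
      right-line : OnLine l c × OnLine l d
      right-bdry : ∀ y → c < y → y < d → ¬ InCol l y
      top    : ∀ j → k ℕ.≤ j → j ℕ.< l → Cut d j
      bottom : ∀ j → k ℕ.≤ j → j ℕ.< l → Cut c j
      no-cut : ∀ y → c < y → y < d → ∀ j → k ℕ.≤ j → j ℕ.< l → ¬ Cut y j

-- The first column of a horizontal rectangle [k,l] × [c,d] lies on one
-- side of the axis, say 0 ≤ c < d ≤ H_k. The k-th vertical line runs from
-- H_{k-1} to H_k and contains c and d; it cannot descend to H_k ≤ c, so it
-- rises and s_k is black. The last column then also lies above the axis,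
-- so d ≤ H_{l-1}; the l-th line cannot rise from H_{l-1} ≤ c, so it descends
-- and s_l is white. Below the axis everything is mirrored.
module Submission where

open import Defs
open import Data.Nat as ℕ using (ℕ; zero; suc; _∸_; z≤n; s≤s)
import Data.Nat.Properties as ℕ
open import Data.Fin.Permutation using (Permutation′)
open import Data.Product using (_×_; _,_; proj₁; proj₂)
open import Data.Sum using (_⊎_; inj₁; inj₂; [_,_]′; swap)
open import Data.Empty using (⊥-elim)
open import Function using (_∘_)
open import Relation.Nullary using (¬_)
open import Relation.Binary.PropositionalEquality using (_≡_; sym; trans; cong; subst; subst₂)
open import Algebra.Structures using (IsAbelianGroup)
open import Relation.Binary.Structures using (IsTotalOrder)
import Relation.Binary.Construct.NonStrictToStrict as NonStrictToStrict

module OrderedAbelianGroupProperties (G : OrderedAbelianGroup) where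
  open OrderedAbelianGroup G
  open IsAbelianGroup isAbelianGroup using (comm; identityˡ; identityʳ)
  open IsTotalOrder isTotalOrder using (total; antisym) renaming (trans to ≤-trans)
  open NonStrictToStrict _≡_ _≤_ using (<-irrefl) renaming (<⇒≱ to <⇒≱′)

  <⇒≱ : ∀ {x y} → x < y → ¬ (y ≤ x)
  <⇒≱ = <⇒≱′ antisym

  ≤-<-≤⇒< : ∀ {a x y b} → a ≤ x → x < y → y ≤ b → a < b
  ≤-<-≤⇒< a≤x x<y@(x≤y , _) y≤b =
    ≤-trans a≤x (≤-trans x≤y y≤b) ,
    λ { a≡b → <⇒≱ x<y (≤-trans y≤b (subst (_≤ _) a≡b a≤x)) }

  x≤0⇒h+x≤h : ∀ h {x} → x ≤ 0# → h + x ≤ h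
  x≤0⇒h+x≤h h x≤0 = subst₂ _≤_ (comm _ h) (identityˡ h) (+-monoˡ-≤ h x≤0)

  0≤x⇒h≤h+x : ∀ h {x} → 0# ≤ x → h ≤ h + x
  0≤x⇒h≤h+x h 0≤x = subst₂ _≤_ (identityˡ h) (comm _ h) (+-monoˡ-≤ h 0≤x)

  h<h+x⇒0<x : ∀ {h x} → h < h + x → 0# < x
  h<h+x⇒0<x {h} {x} h<h+x with total 0# x
  ... | inj₂ x≤0 = ⊥-elim (<⇒≱ h<h+x (x≤0⇒h+x≤h h x≤0))
  ... | inj₁ 0≤x = 0≤x , λ 0≡x →
    <-irrefl (sym (trans (cong (h +_) (sym 0≡x)) (identityʳ h))) h<h+x

  h+x<h⇒x<0 : ∀ {h x} → h + x < h → x < 0#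
  h+x<h⇒x<0 {h} {x} h+x<h with total 0# x
  ... | inj₁ 0≤x = ⊥-elim (<⇒≱ h+x<h (0≤x⇒h≤h+x h 0≤x))
  ... | inj₂ x≤0 = x≤0 , λ x≡0 →
    <-irrefl (trans (cong (h +_) x≡0) (identityʳ h)) h+x<h

  Between-sym : ∀ {a b y} → Between a b y → Between b a y
  Between-sym = swap

  Between-ordered : ∀ {a b y} → a ≤ b → Between a b y → (a ≤ y) × (y ≤ b)
  Between-ordered a≤b (inj₁ a≤y≤b) = a≤y≤b
  Between-ordered a≤b (inj₂ (b≤y , y≤a)) = ≤-trans a≤b b≤y , ≤-trans y≤a a≤b

  Between-lowerEnd : ∀ {a b c d} → c < d → Between a b c → d ≤ b → a ≤ c
  Between-lowerEnd c<d (inj₁ (a≤c , _)) d≤b = a≤c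
  Between-lowerEnd c<d (inj₂ (b≤c , _)) d≤b = ⊥-elim (<⇒≱ c<d (≤-trans d≤b b≤c))

  Between-upperEnd : ∀ {a b c d} → c < d → Between a b d → a ≤ c → d ≤ b
  Between-upperEnd c<d (inj₁ (_ , d≤b)) a≤c = d≤b
  Between-upperEnd c<d (inj₂ (_ , d≤a)) a≤c = ⊥-elim (<⇒≱ c<d (≤-trans d≤a a≤c))

module HRectProperties (G : OrderedAbelianGroup) {N : ℕ}
                       (Ξ : FullPassport G N) (π : Permutation′ N) where
  open OrderedAbelianGroup G
  open OrderedAbelianGroupProperties G
  open Geometry G Ξ π

  rising⇒black : ∀ {j c d} → 1 ℕ.≤ j → H (j ∸ 1) ≤ c → c < d → d ≤ H j → Black j
  rising⇒black {suc j} _ H≤c c<d d≤H = h<h+x⇒0<x (≤-<-≤⇒< H≤c c<d d≤H)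

  falling⇒white : ∀ {j c d} → 1 ℕ.≤ j → H j ≤ c → c < d → d ≤ H (j ∸ 1) → White j
  falling⇒white {suc j} _ H≤c c<d d≤H = h+x<h⇒x<0 (≤-<-≤⇒< H≤c c<d d≤H)

  HRect-firstColumn : ∀ {k l c d} → HRect k l c d → InCol k c × InCol k d
  HRect-firstColumn r = HRect.inside r _ ℕ.≤-refl (HRect.k<l r)

  HRect-lastColumn : ∀ {k l c d} → HRect k l c d → InCol (l ∸ 1) c × InCol (l ∸ 1) d
  HRect-lastColumn {l = zero}  r = ⊥-elim (ℕ.n≮0 (HRect.k<l r))
  HRect-lastColumn {l = suc l} r = HRect.inside r l (ℕ.≤-pred (HRect.k<l r)) ℕ.≤-refl

  module _ {k l c d} (r : HRect k l c d) where
    open HRect r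

    l≥1 : 1 ℕ.≤ l
    l≥1 = ℕ.≤-trans (s≤s z≤n) k<l

    HRect-above : 0# ≤ H k → Black k × White l × (0# ≤ c)
    HRect-above 0≤Hk = black , white , 0≤c
      where
      0≤c : 0# ≤ c
      0≤c = proj₁ (Between-ordered 0≤Hk (proj₁ (HRect-firstColumn r)))
      d≤Hk : d ≤ H k
      d≤Hk = proj₂ (Between-ordered 0≤Hk (proj₂ (HRect-firstColumn r)))
      black : Black k
      black = rising⇒black k≥1 (Between-lowerEnd c<d (proj₁ left-line) d≤Hk) c<d d≤Hk
      d≤Hl′ : d ≤ H (l ∸ 1)
      d≤Hl′ = Between-upperEnd c<d (proj₂ (HRect-lastColumn r)) 0≤c
      white : White l
      white = falling⇒white l≥1
                (Between-lowerEnd c<d (Between-sym (proj₁ right-line)) d≤Hl′) c<d d≤Hl′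

    HRect-below : H k ≤ 0# → White k × Black l × (d ≤ 0#)
    HRect-below Hk≤0 = white , black , d≤0
      where
      Hk≤c : H k ≤ c
      Hk≤c = proj₁ (Between-ordered Hk≤0 (Between-sym (proj₁ (HRect-firstColumn r))))
      d≤0 : d ≤ 0#
      d≤0 = proj₂ (Between-ordered Hk≤0 (Between-sym (proj₂ (HRect-firstColumn r))))
      white : White k
      white = falling⇒white k≥1 Hk≤c c<d
                (Between-upperEnd c<d (Between-sym (proj₂ left-line)) Hk≤c)
      Hl′≤c : H (l ∸ 1) ≤ c
      Hl′≤c = Between-lowerEnd c<d (Between-sym (proj₁ (HRect-lastColumn r))) d≤0
      black : Black l
      black = rising⇒black l≥1 Hl′≤c c<d (Between-upperEnd c<d (proj₂ right-line) Hl′≤c)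

lemma2p3 : (G : OrderedAbelianGroup) (N : ℕ) → 2 ℕ.≤ N →
    (Ξ : FullPassport G N) (P : Permutation′ N) →
    let open OrderedAbelianGroup G
        open Geometry G Ξ P
    in ∀ k l c d → HRect k l c d →
         (Black k × White l × (0# ≤ c)) ⊎ (White k × Black l × (d ≤ 0#))
lemma2p3 G N _ Ξ P k l c d r =
  [ inj₁ ∘ HRect-above r , inj₂ ∘ HRect-below r ]′ (total 0# (H k))
  where
  open OrderedAbelianGroup G
  open IsTotalOrder isTotalOrder using (total)
  open Geometry G Ξ P using (H)
  open HRectProperties G Ξ P
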